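{- Let $A$ be a Heyting algebra, let $B$ be a homomorphic image of $A$, and let $V$ be a variety of Heyting algebras. If $A\in^+V$, then $B\in^+V$.
   Context: A Brouwerian algebra is an algebra $(A,\land,\lor,\to,1)$ in which $(A,\land,\lor)$ is a distributive lattice with top $1$ and $\to$ is relative pseudo-complementation. A Heyting algebra additionally has a constant $0$ which is the least element. For a Heyting algebra $A$, $A^+$ denotes its $\{\land,\lor,\to,1\}$-reduct. A Heyting algebra $A$ is B-embedded in a Heyting algebra $C$ if $A^+$ embeds into $C^+$ as a Brouwerian algebra. For a class $V$ of Heyting algebras, $A\in^+V$ means that $A$ is B-embedded in some member of $V$. -}

module Defs where

open import Level using (Level; _⊔_; 0ℓ)
open import Data.Nat using (ℕ)
open import Data.Product using (Σ; ∃; _×_)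
open import Function using (_∘_)
open import Relation.Binary.Lattice.Bundles using (HeytingAlgebra)

infixr 5 _⇒ₜ_
infixr 6 _∨ₜ_
infixr 7 _∧ₜ_

data Term : Set where
  var        : ℕ → Term
  _∧ₜ_ _∨ₜ_ _⇒ₜ_ : Term → Term → Term
  ⊤ₜ ⊥ₜ      : Term

module _ {c ℓ₁ ℓ₂} (H : HeytingAlgebra c ℓ₁ ℓ₂) where
  open HeytingAlgebra H

  ⟦_⟧ : Term → (ℕ → Carrier) → Carrier
  ⟦ var i ⟧  ρ = ρ i
  ⟦ s ∧ₜ t ⟧ ρ = ⟦ s ⟧ ρ ∧ ⟦ t ⟧ ρ
  ⟦ s ∨ₜ t ⟧ ρ = ⟦ s ⟧ ρ ∨ ⟦ t ⟧ ρ
  ⟦ s ⇒ₜ t ⟧ ρ = ⟦ s ⟧ ρ ⇨ ⟦ t ⟧ ρ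
  ⟦ ⊤ₜ ⟧     ρ = ⊤
  ⟦ ⊥ₜ ⟧     ρ = ⊥

  Satisfies : Term → Term → Set (c ⊔ ℓ₁)
  Satisfies s t = ∀ (ρ : ℕ → Carrier) → ⟦ s ⟧ ρ ≈ ⟦ t ⟧ ρ

-- A variety of Heyting algebras: the class of all Heyting algebras
-- satisfying a given set E of equations (Birkhoff).

record Variety : Set₁ where
  field
    Eqns : Term → Term → Set

_∈V_ : ∀ {c ℓ₁ ℓ₂} → HeytingAlgebra c ℓ₁ ℓ₂ → Variety → Set (c ⊔ ℓ₁)
H ∈V V = ∀ s t → Variety.Eqns V s t → Satisfies H s t

module _ {a aℓ₁ aℓ₂ b bℓ₁ bℓ₂}
         (A : HeytingAlgebra a aℓ₁ aℓ₂) (B : HeytingAlgebra b bℓ₁ bℓ₂) where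
  private
    module A = HeytingAlgebra A
    module B = HeytingAlgebra B

  -- f is a homomorphism of Brouwerian algebras A⁺ → B⁺
  -- (preserves ≈, ∧, ∨, →, 1)
  record IsBrouwerianHom (f : A.Carrier → B.Carrier)
         : Set (a ⊔ aℓ₁ ⊔ bℓ₁) where
    field
      cong   : ∀ {x y} → x A.≈ y → f x B.≈ f y
      pres-∧ : ∀ x y → f (x A.∧ y) B.≈ (f x B.∧ f y)
      pres-∨ : ∀ x y → f (x A.∨ y) B.≈ (f x B.∨ f y)
      pres-⇨ : ∀ x y → f (x A.⇨ y) B.≈ (f x B.⇨ f y)
      pres-⊤ : f A.⊤ B.≈ B.⊤

  record IsHeytingHom (f : A.Carrier → B.Carrier)
         : Set (a ⊔ aℓ₁ ⊔ bℓ₁) where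
    field
      isBrouwerianHom : IsBrouwerianHom f
      pres-⊥          : f A.⊥ B.≈ B.⊥
    open IsBrouwerianHom isBrouwerianHom public

  HomImage : Set (a ⊔ aℓ₁ ⊔ b ⊔ bℓ₁)
  HomImage = Σ (A.Carrier → B.Carrier) λ f →
               IsHeytingHom f × (∀ y → ∃ λ x → f x B.≈ y)

  BEmbedding : Set (a ⊔ aℓ₁ ⊔ b ⊔ bℓ₁)
  BEmbedding = Σ (A.Carrier → B.Carrier) λ f →
                 IsBrouwerianHom f × (∀ {x y} → f x B.≈ f y → x A.≈ y)

-- A ∈⁺ V : A is B-embedded in some member C of V
-- (the witness C is taken with carrier in level c and relations in
--  levels ℓ₁, ℓ₂).

_∈⁺⟨_,_,_⟩_ : ∀ {a aℓ₁ aℓ₂} → HeytingAlgebra a aℓ₁ aℓ₂ →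
              (c ℓ₁ ℓ₂ : Level) → Variety →
              Set (a ⊔ aℓ₁ ⊔ Level.suc (c ⊔ ℓ₁ ⊔ ℓ₂))
A ∈⁺⟨ c , ℓ₁ , ℓ₂ ⟩ V =
  Σ (HeytingAlgebra c ℓ₁ ℓ₂) λ C → (C ∈V V) × BEmbedding A C

-- Let h : A ↠ B be a surjective Heyting homomorphism and f : A⁺ ↪ C⁺ a
-- Brouwerian embedding into some C ∈ V.  The kernel filter h⁻¹(1) of h is
-- pushed forward along f: F is the filter of C generated by f[h⁻¹(1)].
-- Because f is an order embedding that preserves →, one has
--     f x → f x' ∈ F   iff   h x ≤ h x',
-- so the composite A → C → C/F has exactly the kernel of h and therefore
-- induces a Brouwerian embedding B⁺ ↪ (C/F)⁺.  Finally C/F ∈ V, since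
-- varieties are closed under homomorphic images.

module Submission where

open import Defs
open import Level using (Level; _⊔_; Lift; lift)
open import Data.Nat using (ℕ)
open import Function using (_∘_; id)
open import Algebra.Core using (Op₂)
open import Relation.Binary.Core using (_Preserves₂_⟶_⟶_)
open import Relation.Binary.Lattice.Bundles using (HeytingAlgebra)
open import Data.Product using (Σ; ∃; _×_; _,_; proj₁; proj₂)
import Relation.Binary.Reasoning.Setoid as SetoidReasoning
import Relation.Binary.Lattice.Properties.HeytingAlgebra as HeytingProperties
import Relation.Binary.Lattice.Properties.MeetSemilattice as MeetProperties
import Relation.Binary.Lattice.Properties.JoinSemilattice as JoinProperties

module _ {a aℓ₁ aℓ₂ b bℓ₁ bℓ₂}
         {A : HeytingAlgebra a aℓ₁ aℓ₂} {B : HeytingAlgebra b bℓ₁ bℓ₂}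
         {g : HeytingAlgebra.Carrier A → HeytingAlgebra.Carrier B}
         (g-hom : IsBrouwerianHom A B g) where
  private
    module A = HeytingAlgebra A
    module B = HeytingAlgebra B
  open IsBrouwerianHom g-hom
  open MeetProperties A.meetSemilattice using () renaming (y≤x⇒x∧y≈y to A-meet-absorb)
  open MeetProperties B.meetSemilattice using () renaming (y≤x⇒x∧y≈y to B-meet-absorb)

  -- A homomorphism preserves ∧, hence the order it defines (x ≤ y iff y ∧ x ≈ x).
  hom-monotone : ∀ {x y} → x A.≤ y → g x B.≤ g y
  hom-monotone {x} {y} x≤y = B.trans (B.reflexive gx≈gy∧gx) (B.x∧y≤x _ _)
    where
    gx≈gy∧gx : g x B.≈ g y B.∧ g x
    gx≈gy∧gx = B.Eq.trans (cong (A.Eq.sym (A-meet-absorb x≤y))) (pres-∧ y x)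

  hom-reflects-≤ : (∀ {x y} → g x B.≈ g y → x A.≈ y) →
                   ∀ {x y} → g x B.≤ g y → x A.≤ y
  hom-reflects-≤ g-inj {x} {y} gx≤gy = A.trans (A.reflexive (A.Eq.sym y∧x≈x)) (A.x∧y≤x _ _)
    where
    y∧x≈x : y A.∧ x A.≈ x
    y∧x≈x = g-inj (B.Eq.trans (pres-∧ y x) (B-meet-absorb gx≤gy))

∘-isBrouwerianHom :
  ∀ {a aℓ₁ aℓ₂ b bℓ₁ bℓ₂ d dℓ₁ dℓ₂}
    {A : HeytingAlgebra a aℓ₁ aℓ₂} {B : HeytingAlgebra b bℓ₁ bℓ₂}
    {D : HeytingAlgebra d dℓ₁ dℓ₂}
    {g : HeytingAlgebra.Carrier B → HeytingAlgebra.Carrier D}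
    {f : HeytingAlgebra.Carrier A → HeytingAlgebra.Carrier B} →
  IsBrouwerianHom B D g → IsBrouwerianHom A B f → IsBrouwerianHom A D (g ∘ f)
∘-isBrouwerianHom {D = D} g-hom f-hom = record
  { cong   = g.cong ∘ f.cong
  ; pres-∧ = λ x y → D.Eq.trans (g.cong (f.pres-∧ x y)) (g.pres-∧ _ _)
  ; pres-∨ = λ x y → D.Eq.trans (g.cong (f.pres-∨ x y)) (g.pres-∨ _ _)
  ; pres-⇨ = λ x y → D.Eq.trans (g.cong (f.pres-⇨ x y)) (g.pres-⇨ _ _)
  ; pres-⊤ = D.Eq.trans (g.cong f.pres-⊤) g.pres-⊤
  }
  where
  module D = HeytingAlgebra D
  module g = IsBrouwerianHom g-hom
  module f = IsBrouwerianHom f-hom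

module _ {c ℓ₁ ℓ₂ d dℓ₁ dℓ₂}
         {C : HeytingAlgebra c ℓ₁ ℓ₂} {D : HeytingAlgebra d dℓ₁ dℓ₂} where
  private
    module C = HeytingAlgebra C
    module D = HeytingAlgebra D
  open HeytingProperties D using (⇨-cong)
  open MeetProperties D.meetSemilattice using (∧-cong)
  open JoinProperties D.joinSemilattice using (∨-cong)

  hom-⟦⟧ : ∀ {g} → IsHeytingHom C D g →
           ∀ t {σ ρ} → (∀ i → g (σ i) D.≈ ρ i) → g (⟦ C ⟧ t σ) D.≈ ⟦ D ⟧ t ρ
  hom-⟦⟧ g-hom (var i)  gσ≈ρ = gσ≈ρ i
  hom-⟦⟧ g-hom (s ∧ₜ t) gσ≈ρ = D.Eq.trans (IsHeytingHom.pres-∧ g-hom _ _)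
                                 (∧-cong (hom-⟦⟧ g-hom s gσ≈ρ) (hom-⟦⟧ g-hom t gσ≈ρ))
  hom-⟦⟧ g-hom (s ∨ₜ t) gσ≈ρ = D.Eq.trans (IsHeytingHom.pres-∨ g-hom _ _)
                                 (∨-cong (hom-⟦⟧ g-hom s gσ≈ρ) (hom-⟦⟧ g-hom t gσ≈ρ))
  hom-⟦⟧ g-hom (s ⇒ₜ t) gσ≈ρ = D.Eq.trans (IsHeytingHom.pres-⇨ g-hom _ _)
                                 (⇨-cong (hom-⟦⟧ g-hom s gσ≈ρ) (hom-⟦⟧ g-hom t gσ≈ρ))
  hom-⟦⟧ g-hom ⊤ₜ       _    = IsHeytingHom.pres-⊤ g-hom
  hom-⟦⟧ g-hom ⊥ₜ       _    = IsHeytingHom.pres-⊥ g-hom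

  -- Every valuation in D lifts along a surjection, so equations of C pass to D.
  homImage-∈V : (V : Variety) → HomImage C D → C ∈V V → D ∈V V
  homImage-∈V V (g , g-hom , g-onto) C∈V s t s≈t∈V ρ = begin
    ⟦ D ⟧ s ρ       ≈⟨ hom-⟦⟧ g-hom s lift-ρ ⟨
    g (⟦ C ⟧ s σ)   ≈⟨ IsHeytingHom.cong g-hom (C∈V s t s≈t∈V σ) ⟩
    g (⟦ C ⟧ t σ)   ≈⟨ hom-⟦⟧ g-hom t lift-ρ ⟩
    ⟦ D ⟧ t ρ       ∎
    where
    open SetoidReasoning D.setoid
    σ : ℕ → C.Carrier
    σ i = proj₁ (g-onto (ρ i))
    lift-ρ : ∀ i → g (σ i) D.≈ ρ i
    lift-ρ i = proj₂ (g-onto (ρ i))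

record IsFilter {c ℓ₁ ℓ₂ L} (C : HeytingAlgebra c ℓ₁ ℓ₂)
                (F : HeytingAlgebra.Carrier C → Set L) : Set (c ⊔ ℓ₂ ⊔ L) where
  open HeytingAlgebra C
  field
    ⊤∈ : F ⊤
    up : ∀ {x y} → F x → x ≤ y → F y
    ∧∈ : ∀ {x y} → F x → F y → F (x ∧ y)

-- The quotient C/F lives on the carrier of C, ordered by x ≤ y iff
-- x ⇨ y ∈ F.  The level T only enlarges the universe of that relation.
module Quotient {c ℓ₁ ℓ₂ L} (C : HeytingAlgebra c ℓ₁ ℓ₂)
                {F : HeytingAlgebra.Carrier C → Set L} (F-filter : IsFilter C F)
                (T : Level) where
  open HeytingAlgebra C
  open IsFilter F-filter
  open HeytingProperties C
    using (⇨-eval; ⇨-curry; ⇨-distribˡ-∧-≥; ⇨-distribˡ-∨-∧-≥)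
  open MeetProperties meetSemilattice using (∧-monotonic)

  ≤⇒⇨∈ : ∀ {x y} → x ≤ y → F (x ⇨ y)
  ≤⇒⇨∈ x≤y = up ⊤∈ (transpose-⇨ (trans (x∧y≤y _ _) x≤y))

  ∧∈-up : ∀ {x y z} → F x → F y → x ∧ y ≤ z → F z
  ∧∈-up x∈ y∈ x∧y≤z = up (∧∈ x∈ y∈) x∧y≤z

  ⇨-compose : ∀ {x y z} → (x ⇨ y) ∧ (y ⇨ z) ≤ x ⇨ z
  ⇨-compose {x} {y} {z} =
    transpose-⇨ (trans (∧-greatest (trans (x∧y≤x _ _) (x∧y≤y _ _)) reaches-y) ⇨-eval)
    where
    reaches-y : ((x ⇨ y) ∧ (y ⇨ z)) ∧ x ≤ y
    reaches-y = trans (∧-monotonic (x∧y≤x _ _) refl) ⇨-eval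

  infix 4 _≤F_ _≈F_

  _≤F_ : Carrier → Carrier → Set (L ⊔ T)
  x ≤F y = Lift T (F (x ⇨ y))

  _≈F_ : Carrier → Carrier → Set (L ⊔ T)
  x ≈F y = x ≤F y × y ≤F x

  ≤⇒≤F : ∀ {x y} → x ≤ y → x ≤F y
  ≤⇒≤F x≤y = lift (≤⇒⇨∈ x≤y)

  ≤F-trans : ∀ {x y z} → x ≤F y → y ≤F z → x ≤F z
  ≤F-trans (lift p) (lift q) = lift (∧∈-up p q ⇨-compose)

  ≈⇒≈F : ∀ {x y} → x ≈ y → x ≈F y
  ≈⇒≈F x≈y = ≤⇒≤F (reflexive x≈y) , ≤⇒≤F (reflexive (Eq.sym x≈y))

  quotient : HeytingAlgebra c (L ⊔ T) (L ⊔ T)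
  quotient = record
    { Carrier = Carrier ; _≈_ = _≈F_ ; _≤_ = _≤F_
    ; _∨_ = _∨_ ; _∧_ = _∧_ ; _⇨_ = _⇨_ ; ⊤ = ⊤ ; ⊥ = ⊥
    ; isHeytingAlgebra = record
      { isBoundedLattice = record
        { isLattice = record
          { isPartialOrder = record
            { isPreorder = record
              { isEquivalence = record
                { refl  = ≈⇒≈F Eq.refl
                ; sym   = λ (p , q) → q , p
                ; trans = λ (p , q) (p′ , q′) → ≤F-trans p p′ , ≤F-trans q′ q
                }
              ; reflexive = proj₁
              ; trans     = ≤F-trans
              }
            ; antisym = _,_
            }
          ; supremum = λ x y →
              ≤⇒≤F (x≤x∨y x y) , ≤⇒≤F (y≤x∨y x y) ,
              λ z (lift p) (lift q) → lift (∧∈-up p q (⇨-distribˡ-∨-∧-≥ x y z))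
          ; infimum = λ x y →
              ≤⇒≤F (x∧y≤x x y) , ≤⇒≤F (x∧y≤y x y) ,
              λ z (lift p) (lift q) → lift (∧∈-up p q (⇨-distribˡ-∧-≥ z x y))
          }
        ; maximum = ≤⇒≤F ∘ maximum
        ; minimum = ≤⇒≤F ∘ minimum
        }
      ; exponential = λ w x y →
          (λ (lift p) → lift (up p (reflexive ⇨-curry))) ,
          (λ (lift p) → lift (up p (reflexive (Eq.sym ⇨-curry))))
      }
    }

  quotientMap-isHeytingHom : IsHeytingHom C quotient id
  quotientMap-isHeytingHom = record
    { isBrouwerianHom = record
      { cong   = ≈⇒≈F
      ; pres-∧ = λ _ _ → ≈⇒≈F Eq.refl
      ; pres-∨ = λ _ _ → ≈⇒≈F Eq.refl
      ; pres-⇨ = λ _ _ → ≈⇒≈F Eq.refl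
      ; pres-⊤ = ≈⇒≈F Eq.refl
      }
    ; pres-⊥ = ≈⇒≈F Eq.refl
    }

  quotient-homImage : HomImage C quotient
  quotient-homImage = id , quotientMap-isHeytingHom , λ y → y , ≈⇒≈F Eq.refl

-- If h : A ↠ B is onto and g : A → D has exactly the kernel of h, then
-- y ↦ g (any h-preimage of y) is a Brouwerian embedding B⁺ ↪ D⁺.
module Factorisation
  {a aℓ₁ aℓ₂ b bℓ₁ bℓ₂ d dℓ₁ dℓ₂}
  {A : HeytingAlgebra a aℓ₁ aℓ₂} {B : HeytingAlgebra b bℓ₁ bℓ₂}
  {D : HeytingAlgebra d dℓ₁ dℓ₂}
  {h : HeytingAlgebra.Carrier A → HeytingAlgebra.Carrier B}
  {g : HeytingAlgebra.Carrier A → HeytingAlgebra.Carrier D}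
  (h-hom : IsBrouwerianHom A B h)
  (h-onto : ∀ y → ∃ λ x → HeytingAlgebra._≈_ B (h x) y)
  (g-hom : IsBrouwerianHom A D g)
  (ker-h⊆ker-g : ∀ {x x′} → HeytingAlgebra._≈_ B (h x) (h x′) →
                             HeytingAlgebra._≈_ D (g x) (g x′))
  (ker-g⊆ker-h : ∀ {x x′} → HeytingAlgebra._≈_ D (g x) (g x′) →
                             HeytingAlgebra._≈_ B (h x) (h x′))
  where
  private
    module A = HeytingAlgebra A
    module B = HeytingAlgebra B
    module D = HeytingAlgebra D
    module h = IsBrouwerianHom h-hom
    module g = IsBrouwerianHom g-hom
  open HeytingProperties B using (⇨-cong)
  open MeetProperties B.meetSemilattice using (∧-cong)
  open JoinProperties B.joinSemilattice using (∨-cong)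

  preimage : B.Carrier → A.Carrier
  preimage y = proj₁ (h-onto y)

  h-preimage : ∀ y → h (preimage y) B.≈ y
  h-preimage y = proj₂ (h-onto y)

  induced : B.Carrier → D.Carrier
  induced = g ∘ preimage

  -- The induced map respects every operation preserved by both h and g;
  -- by the kernel condition the choice of preimages is irrelevant.
  induced-pres₂ :
    ∀ (_∙ᴬ_ : Op₂ A.Carrier) (_∙ᴮ_ : Op₂ B.Carrier) (_∙ᴰ_ : Op₂ D.Carrier) →
    _∙ᴮ_ Preserves₂ B._≈_ ⟶ B._≈_ ⟶ B._≈_ →
    (∀ x x′ → h (x ∙ᴬ x′) B.≈ h x ∙ᴮ h x′) →
    (∀ x x′ → g (x ∙ᴬ x′) D.≈ g x ∙ᴰ g x′) →
    ∀ y y′ → induced (y ∙ᴮ y′) D.≈ induced y ∙ᴰ induced y′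
  induced-pres₂ _∙ᴬ_ _∙ᴮ_ _∙ᴰ_ ∙ᴮ-cong h-pres g-pres y y′ =
    D.Eq.trans (ker-h⊆ker-g same-image) (g-pres _ _)
    where
    open SetoidReasoning B.setoid
    same-image : h (preimage (y ∙ᴮ y′)) B.≈ h (preimage y ∙ᴬ preimage y′)
    same-image = begin
      h (preimage (y ∙ᴮ y′))              ≈⟨ h-preimage _ ⟩
      y ∙ᴮ y′                             ≈⟨ ∙ᴮ-cong (h-preimage y) (h-preimage y′) ⟨
      h (preimage y) ∙ᴮ h (preimage y′)   ≈⟨ h-pres _ _ ⟨
      h (preimage y ∙ᴬ preimage y′)       ∎

  induced-isBrouwerianHom : IsBrouwerianHom B D induced
  induced-isBrouwerianHom = record
    { cong   = λ {y} {y′} y≈y′ → ker-h⊆ker-g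
                 (B.Eq.trans (h-preimage y) (B.Eq.trans y≈y′ (B.Eq.sym (h-preimage y′))))
    ; pres-∧ = induced-pres₂ A._∧_ B._∧_ D._∧_ ∧-cong h.pres-∧ g.pres-∧
    ; pres-∨ = induced-pres₂ A._∨_ B._∨_ D._∨_ ∨-cong h.pres-∨ g.pres-∨
    ; pres-⇨ = induced-pres₂ A._⇨_ B._⇨_ D._⇨_ ⇨-cong h.pres-⇨ g.pres-⇨
    ; pres-⊤ = D.Eq.trans (ker-h⊆ker-g (B.Eq.trans (h-preimage B.⊤) (B.Eq.sym h.pres-⊤)))
                          g.pres-⊤
    }

  induced-injective : ∀ {y y′} → induced y D.≈ induced y′ → y B.≈ y′
  induced-injective {y} {y′} e =
    B.Eq.trans (B.Eq.sym (h-preimage y)) (B.Eq.trans (ker-g⊆ker-h e) (h-preimage y′))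

  induced-embedding : BEmbedding B D
  induced-embedding = induced , induced-isBrouwerianHom , induced-injective

module PushedKernelFilter
  {a aℓ₁ aℓ₂ b bℓ₁ bℓ₂ c ℓ₁ ℓ₂}
  {A : HeytingAlgebra a aℓ₁ aℓ₂} {B : HeytingAlgebra b bℓ₁ bℓ₂}
  {C : HeytingAlgebra c ℓ₁ ℓ₂}
  {h : HeytingAlgebra.Carrier A → HeytingAlgebra.Carrier B}
  {f : HeytingAlgebra.Carrier A → HeytingAlgebra.Carrier C}
  (h-hom : IsHeytingHom A B h)
  (f-hom : IsBrouwerianHom A C f)
  (f-inj : ∀ {x y} → HeytingAlgebra._≈_ C (f x) (f y) → HeytingAlgebra._≈_ A x y)
  (T : Level)
  where
  private
    module A = HeytingAlgebra A
    module B = HeytingAlgebra B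
    module C = HeytingAlgebra C
    module h = IsHeytingHom h-hom
    module f = IsBrouwerianHom f-hom

  -- F is the filter of C generated by f[h⁻¹(1)]: z ∈ F iff z lies above
  -- f u for some u with h u = 1.
  F : C.Carrier → Set (a ⊔ bℓ₂ ⊔ ℓ₂)
  F z = Σ A.Carrier λ u → (B.⊤ B.≤ h u) × (f u C.≤ z)

  F-isFilter : IsFilter C F
  F-isFilter = record
    { ⊤∈ = A.⊤ , B.reflexive (B.Eq.sym h.pres-⊤) , C.maximum _
    ; up = λ (u , ⊤≤hu , fu≤x) x≤y → u , ⊤≤hu , C.trans fu≤x x≤y
    ; ∧∈ = λ (u , ⊤≤hu , fu≤x) (v , ⊤≤hv , fv≤y) →
        u A.∧ v ,
        B.trans (B.∧-greatest ⊤≤hu ⊤≤hv) (B.reflexive (B.Eq.sym (h.pres-∧ u v))) ,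
        C.trans (C.reflexive (f.pres-∧ u v)) (C.∧-greatest
          (C.trans (C.x∧y≤x _ _) fu≤x) (C.trans (C.x∧y≤y _ _) fv≤y))
    }

  ⊤≤⇨⇒≤ : ∀ {x y} → B.⊤ B.≤ x B.⇨ y → x B.≤ y
  ⊤≤⇨⇒≤ ⊤≤x⇨y = B.trans (B.∧-greatest (B.maximum _) B.refl) (B.transpose-∧ ⊤≤x⇨y)

  ≤⇒⊤≤⇨ : ∀ {x y} → x B.≤ y → B.⊤ B.≤ x B.⇨ y
  ≤⇒⊤≤⇨ x≤y = B.transpose-⇨ (B.trans (B.x∧y≤y _ _) x≤y)

  ≤⇒⇨∈F : ∀ {x x′} → h x B.≤ h x′ → F (f x C.⇨ f x′)
  ≤⇒⇨∈F {x} {x′} hx≤hx′ =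
    x A.⇨ x′ ,
    B.trans (≤⇒⊤≤⇨ hx≤hx′) (B.reflexive (B.Eq.sym (h.pres-⇨ x x′))) ,
    C.reflexive (f.pres-⇨ x x′)

  ⇨∈F⇒≤ : ∀ {x x′} → F (f x C.⇨ f x′) → h x B.≤ h x′
  ⇨∈F⇒≤ {x} {x′} (u , ⊤≤hu , fu≤fx⇨fx′) = ⊤≤⇨⇒≤ (B.trans ⊤≤hu hu≤hx⇨hx′)
    where
    -- f is an order embedding, so u ≤ x ⇨ x′ already holds in A
    u≤x⇨x′ : u A.≤ x A.⇨ x′
    u≤x⇨x′ = hom-reflects-≤ f-hom f-inj
               (C.trans fu≤fx⇨fx′ (C.reflexive (C.Eq.sym (f.pres-⇨ x x′))))
    hu≤hx⇨hx′ : h u B.≤ h x B.⇨ h x′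
    hu≤hx⇨hx′ = B.trans (hom-monotone h.isBrouwerianHom u≤x⇨x′)
                        (B.reflexive (h.pres-⇨ x x′))

  open Quotient C F-isFilter T public

  f/F-isBrouwerianHom : IsBrouwerianHom A quotient f
  f/F-isBrouwerianHom =
    ∘-isBrouwerianHom (IsHeytingHom.isBrouwerianHom quotientMap-isHeytingHom) f-hom

  ker-h⊆ker-f/F : ∀ {x x′} → h x B.≈ h x′ → f x ≈F f x′
  ker-h⊆ker-f/F e = lift (≤⇒⇨∈F (B.reflexive e)) , lift (≤⇒⇨∈F (B.reflexive (B.Eq.sym e)))

  ker-f/F⊆ker-h : ∀ {x x′} → f x ≈F f x′ → h x B.≈ h x′
  ker-f/F⊆ker-h (lift p , lift q) = B.antisym (⇨∈F⇒≤ p) (⇨∈F⇒≤ q)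

  B-embedding : (∀ y → ∃ λ x → h x B.≈ y) → BEmbedding B quotient
  B-embedding h-onto = Factorisation.induced-embedding
    h.isBrouwerianHom h-onto f/F-isBrouwerianHom ker-h⊆ker-f/F ker-f/F⊆ker-h

mainTheorem5 : ∀ {a aℓ₁ aℓ₂ b bℓ₁ bℓ₂ c ℓ₁ ℓ₂ : Level}
                 (A : HeytingAlgebra a aℓ₁ aℓ₂) (B : HeytingAlgebra b bℓ₁ bℓ₂)
                 (V : Variety) →
                 HomImage A B →
                 A ∈⁺⟨ c , ℓ₁ , ℓ₂ ⟩ V →
                 B ∈⁺⟨ c , a ⊔ aℓ₁ ⊔ aℓ₂ ⊔ b ⊔ bℓ₁ ⊔ bℓ₂ ⊔ c ⊔ ℓ₁ ⊔ ℓ₂ , a ⊔ aℓ₁ ⊔ aℓ₂ ⊔ b ⊔ bℓ₁ ⊔ bℓ₂ ⊔ c ⊔ ℓ₁ ⊔ ℓ₂ ⟩ V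
mainTheorem5 {a} {aℓ₁} {aℓ₂} {b} {bℓ₁} {bℓ₂} {c} {ℓ₁} {ℓ₂}
             A B V (h , h-hom , h-onto) (C , C∈V , f , f-hom , f-inj) =
  quotient , homImage-∈V V quotient-homImage C∈V , B-embedding h-onto
  where
  open PushedKernelFilter h-hom f-hom f-inj (a ⊔ aℓ₁ ⊔ aℓ₂ ⊔ b ⊔ bℓ₁ ⊔ bℓ₂ ⊔ c ⊔ ℓ₁ ⊔ ℓ₂)
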